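{- Let $q = q_0^2$ where $q_0$ is a prime power. Let $G'$ be the bipartite graph obtained from the point-line incidence graph of the projective plane $\mathrm{PG}(2,q_0)$ by fixing a line $L$ and a point $P$ on $L$, removing all points on $L$ and removing all lines through $P$; then $G'$ has $q$ points and $q$ lines. Identify the set of remaining points and the set of remaining lines each with a copy of $\mathbb{F}_q$ via arbitrary bijections, and let \[ X'' = \{ \langle (1, x, x^2, x^3, y, y^2, y^3)\rangle : x, y \in \mathbb{F}_q,\ \text{the point } x \text{ and the line } y \text{ are adjacent (incident) in } G' \} \subseteq \mathrm{PG}(6,q). \] Then $|X''| = q^{3/2}$ and $X''$ is a $(3,2)$-set, i.e. no plane of $\mathrm{PG}(6,q)$ contains more than $3$ points of $X''$.
   Context: $\mathrm{PG}(m,q)$ is the projective space whose points, lines and planes are the $1$-, $2$- and $3$-dimensional subspaces of $\mathbb{F}_q^{m+1}$. A $(3,2)$-set is a set of points meeting every plane in at most $3$ points. -}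

module Defs where

open import Level using (0ℓ)
open import Data.Nat using (ℕ; _≤_; _^_)
open import Data.Fin using (Fin; zero; suc)
open import Data.Product using (Σ; ∃; ∃-syntax; _×_; _,_)
open import Data.List using (List; length)
open import Data.List.Relation.Unary.All using (All)
open import Data.List.Relation.Unary.Any using (Any)
open import Data.List.Relation.Unary.AllPairs using (AllPairs)
open import Relation.Nullary using (¬_)
open import Relation.Binary.PropositionalEquality using (_≡_; _≢_)
open import Algebra.Structures using (IsCommutativeRing)
open import Function.Bundles using (_↔_)

record FiniteField (q : ℕ) : Set₁ where
  infixl 6 _+_
  infixl 7 _*_
  field
    Carrier : Set
    _+_ _*_ : Carrier → Carrier → Carrier
    -_      : Carrier → Carrier
    0# 1#   : Carrier
    isCommutativeRing : IsCommutativeRing _≡_ _+_ _*_ -_ 0# 1#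
    0≢1     : 0# ≢ 1#
    inverse : ∀ x → x ≢ 0# → ∃[ y ] (x * y ≡ 1#)
    enumeration : Fin q ↔ Carrier

El : {q : ℕ} → FiniteField q → Set
El F = FiniteField.Carrier F

module LinAlg {q : ℕ} (F : FiniteField q) where
  open FiniteField F

  Vec : ℕ → Set
  Vec n = Fin n → Carrier

  NonZeroV : ∀ {n} → Vec n → Set
  NonZeroV v = ¬ (∀ i → v i ≡ 0#)

  _∼_ : ∀ {n} → Vec n → Vec n → Set
  v ∼ w = ∃[ c ] (c ≢ 0# × (∀ i → v i ≡ c * w i))

  LinIndep2 : ∀ {n} → Vec n → Vec n → Set
  LinIndep2 a b = ∀ s t → (∀ i → s * a i + t * b i ≡ 0#) → (s ≡ 0# × t ≡ 0#)

  LinIndep3 : ∀ {n} → Vec n → Vec n → Vec n → Set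
  LinIndep3 a b c = ∀ s t r → (∀ i → s * a i + t * b i + r * c i ≡ 0#)
                    → (s ≡ 0# × t ≡ 0# × r ≡ 0#)

  InSpan2 : ∀ {n} → Vec n → Vec n → Vec n → Set
  InSpan2 v a b = ∃[ s ] ∃[ t ] (∀ i → v i ≡ s * a i + t * b i)

  InSpan3 : ∀ {n} → Vec n → Vec n → Vec n → Vec n → Set
  InSpan3 v a b c = ∃[ s ] ∃[ t ] ∃[ r ] (∀ i → v i ≡ s * a i + t * b i + r * c i)

-- The projective plane PG(2,q0) over K.
-- Points: nonzero vectors of K^3 up to ∼.
-- Lines: 2-dimensional subspaces of K^3, represented by a pair of
-- linearly independent spanning vectors.

module PG2 {q0 : ℕ} (K : FiniteField q0) where
  open LinAlg K public

  LineRep : Set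
  LineRep = Vec 3 × Vec 3

  IsLine : LineRep → Set
  IsLine (a , b) = LinIndep2 a b

  OnLine : Vec 3 → LineRep → Set
  OnLine p (a , b) = InSpan2 p a b

  SameLine : LineRep → LineRep → Set
  SameLine (a , b) (a' , b') =
    (InSpan2 a a' b' × InSpan2 b a' b') × (InSpan2 a' a b × InSpan2 b' a b)

  IsPointBijection : {A : Set} → LineRep → (A → Vec 3) → Set
  IsPointBijection {A} L φ =
    (∀ x → NonZeroV (φ x) × ¬ OnLine (φ x) L) ×
    (∀ x x' → φ x ∼ φ x' → x ≡ x') ×
    (∀ p → NonZeroV p → ¬ OnLine p L → ∃[ x ] (p ∼ φ x))

  IsLineBijection : {A : Set} → Vec 3 → (A → LineRep) → Set
  IsLineBijection {A} P ψ =
    (∀ y → IsLine (ψ y) × ¬ OnLine P (ψ y)) ×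
    (∀ y y' → SameLine (ψ y) (ψ y') → y ≡ y') ×
    (∀ ℓ → IsLine ℓ → ¬ OnLine P ℓ → ∃[ y ] SameLine ℓ (ψ y))

module Construction {q0 : ℕ} (K : FiniteField q0) (F : FiniteField (q0 ^ 2)) where
  open PG2 K using (LineRep; OnLine)
  open FiniteField F
  open LinAlg F

  cube : El F → El F
  cube x = x * x * x

  ν : El F → El F → Vec 7
  ν x y zero = 1#
  ν x y (suc zero) = x
  ν x y (suc (suc zero)) = x * x
  ν x y (suc (suc (suc zero))) = cube x
  ν x y (suc (suc (suc (suc zero)))) = y
  ν x y (suc (suc (suc (suc (suc zero))))) = y * y
  ν x y (suc (suc (suc (suc (suc (suc zero)))))) = cube y

  InX'' : (El F → PG2.Vec K 3) → (El F → LineRep) → Vec 7 → Set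
  InX'' φ ψ v = ∃[ x ] ∃[ y ] (OnLine (φ x) (ψ y) × v ∼ ν x y)

  Distinct : List (Vec 7) → Set
  Distinct = AllPairs (λ v w → ¬ v ∼ w)

  HasSize : (Vec 7 → Set) → ℕ → Set
  HasSize X N = Σ (List (Vec 7)) λ vs →
    length vs ≡ N × All X vs × Distinct vs ×
    (∀ v → X v → Any (λ w → v ∼ w) vs)

  Is32Set : (Vec 7 → Set) → Set
  Is32Set X = ∀ a b c → LinIndep3 a b c →
    ∀ (vs : List (Vec 7)) → All X vs → Distinct vs →
    All (λ v → InSpan3 v a b c) vs → length vs ≤ 3

{-# OPTIONS --safe #-}
module Submission where

-- X″ has one point ν(x, y) per flag of G′, and ν is injective. Every line of G′ is a line of
-- PG(2, q₀) avoiding P, so it meets L in exactly one point and carries q₀ points of G′: there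
-- are q₀² · q₀ = q^{3/2} flags.
--
-- Four points of X″ in a plane satisfy a relation Σ cᵢ ν(xᵢ, yᵢ) = 0. Coordinates 0–3 and
-- 0, 4–6 of ν are the twisted cubic (1, z, z², z³) in x and in y, and a linear relation among
-- points of the twisted cubic cannot involve a parameter only once. So every xᵢ with cᵢ ≠ 0
-- recurs at another index with nonzero coefficient, and so does every yᵢ. Chasing these
-- coincidences through four distinct flags yields two points of G′ joined by two lines,
-- impossible in a projective plane.

open import Defs
open import Level using (0ℓ)
open import Function using (_∘_)
open import Function.Bundles using (Inverse)
open import Data.Empty using (⊥; ⊥-elim)
open import Data.Product using (Σ; ∃-syntax; _×_; _,_; proj₁; proj₂)
open import Data.Maybe as Maybe using (Maybe)
open import Data.Nat as ℕ using (ℕ; zero; suc; _^_)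
import Data.Nat.Properties as ℕP
open import Data.Integer as ℤ using (ℤ; -[1+_]; _⊖_)
import Data.Integer.Properties as ℤP
open import Data.Fin as Fin using (Fin; zero; suc; punchIn)
import Data.Fin.Properties as FinP
open import Data.Vec.Functional using (insertAt)
open import Data.Vec.Functional.Properties using (insertAt-lookup; insertAt-punchIn)
open import Data.List as List using (List; []; _∷_; length; map; filter; concatMap)
import Data.List.Properties as ListP
open import Data.List.Membership.Propositional using (_∈_; find)
import Data.List.Membership.Propositional.Properties as MemP
open import Data.List.Relation.Unary.All as All using (All; []; _∷_)
import Data.List.Relation.Unary.All.Properties as AllP
open import Data.List.Relation.Unary.Any as Any using (Any; here; there)
import Data.List.Relation.Unary.Any.Properties as AnyP
open import Data.List.Relation.Unary.AllPairs as AllPairs using (AllPairs; []; _∷_)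
import Data.List.Relation.Unary.AllPairs.Properties as AllPairsP
open import Data.List.Relation.Unary.Unique.Propositional using (Unique)
import Data.List.Relation.Unary.Unique.Propositional.Properties as UniqueP
open import Data.List.Relation.Binary.Disjoint.Propositional using (Disjoint)
open import Relation.Nullary using (¬_; ¬?; Dec; yes; no; dec⇒maybe)
open import Relation.Nullary.Decidable using (map′; decidable-stable; from-yes; _×-dec_; _→-dec_)
open import Relation.Unary using (Decidable)
open import Relation.Binary.Definitions using (DecidableEquality)
open import Relation.Binary.PropositionalEquality
  using (_≡_; _≢_; refl; sym; trans; cong; cong₂; subst; subst₂; module ≡-Reasoning)
open import Algebra.Bundles using (CommutativeRing)
import Algebra.Properties.Ring as RingProperties
import Algebra.Properties.Semiring.Mult.TCOptimised as SemiringMult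
import Algebra.Properties.CommutativeMonoid.Sum as CommutativeMonoidSum
import Algebra.Properties.Semiring.Sum as SemiringSum
import Algebra.Solver.Ring.AlmostCommutativeRing as ACR
open ACR using (AlmostCommutativeRing)

pair : {A : Set} → A → A → Fin 2 → A
pair a b zero       = a
pair a b (suc zero) = b

triple : {A : Set} → A → A → A → Fin 3 → A
triple a b c zero             = a
triple a b c (suc zero)       = b
triple a b c (suc (suc zero)) = c

module _ {A : Set} where

  AllPairs-with : ∀ {Q : A → Set} {R S : A → A → Set} → (∀ {x y} → Q x → Q y → R x y → S x y) →
    ∀ {xs} → All Q xs → AllPairs R xs → AllPairs S xs
  AllPairs-with f []         []         = []
  AllPairs-with f (qx ∷ qxs) (rx ∷ rxs) = All.zipWith (λ (qy , r) → f qx qy r) (qxs , rx) ∷ AllPairs-with f qxs rxs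

  length-filter-reject-unique : ∀ {P : A → Set} (P? : Decidable P) {xs} →
    AllPairs (λ x y → P x → ¬ P y) xs → Any P xs → suc (length (filter (¬? ∘ P?) xs)) ≡ length xs
  length-filter-reject-unique P? {x ∷ xs} (exclusive ∷ rest) any-P with P? x
  ... | yes Px = cong (suc ∘ length) (ListP.filter-all (¬? ∘ P?) (All.map (λ ¬P → ¬P Px) exclusive))
  ... | no ¬Px = cong suc (length-filter-reject-unique P? rest (tail any-P))
    where
    tail : Any _ (x ∷ xs) → Any _ xs
    tail (here Px)   = ⊥-elim (¬Px Px)
    tail (there pxs) = pxs

length-concatMap : ∀ {A B : Set} (f : A → List B) {k} → (∀ x → length (f x) ≡ k) →
  ∀ xs → length (concatMap f xs) ≡ length xs ℕ.* k
length-concatMap f |f|≡k []       = refl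
length-concatMap f |f|≡k (x ∷ xs) =
  trans (ListP.length-++ (f x)) (cong₂ ℕ._+_ (|f|≡k x) (length-concatMap f |f|≡k xs))

AllPairs-tabulate⁻ : ∀ {A : Set} {R : A → A → Set} → (∀ {x y} → R x y → R y x) →
  ∀ {n} {f : Fin n → A} → AllPairs R (List.tabulate f) → ∀ {i j} → i ≢ j → R (f i) (f j)
AllPairs-tabulate⁻ R-sym (r ∷ rs) {zero}  {zero}  i≢j = ⊥-elim (i≢j refl)
AllPairs-tabulate⁻ R-sym (r ∷ rs) {zero}  {suc j} _   = AllP.tabulate⁻ r j
AllPairs-tabulate⁻ R-sym (r ∷ rs) {suc i} {zero}  _   = R-sym (AllP.tabulate⁻ r i)
AllPairs-tabulate⁻ R-sym (r ∷ rs) {suc i} {suc j} i≢j = AllPairs-tabulate⁻ R-sym rs (i≢j ∘ cong suc)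

Paired : ∀ {m} {A : Set} → (Fin m → Set) → (Fin m → A) → Set
Paired S Z = ∀ i → S i → ∃[ j ] (j ≢ i × Z j ≡ Z i × S j)

avoid-three-unique : (a b c d e : Fin 4) → a ≢ b → a ≢ c → b ≢ c →
  d ≢ a → d ≢ b → d ≢ c → e ≢ a → e ≢ b → e ≢ c → d ≡ e
avoid-three-unique = from-yes
  (FinP.all? {n = 4} λ a → FinP.all? {n = 4} λ b → FinP.all? {n = 4} λ c →
   FinP.all? {n = 4} λ d → FinP.all? {n = 4} λ e →
   ¬? (a Fin.≟ b) →-dec ¬? (a Fin.≟ c) →-dec ¬? (b Fin.≟ c) →-dec
   ¬? (d Fin.≟ a) →-dec ¬? (d Fin.≟ b) →-dec ¬? (d Fin.≟ c) →-dec
   ¬? (e Fin.≟ a) →-dec ¬? (e Fin.≟ b) →-dec ¬? (e Fin.≟ c) →-dec d Fin.≟ e)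

module Incidence {A B : Set} (I : A → B → Set) where

  NoQuadrangle : Set
  NoQuadrangle = ∀ {x x′ y y′} → x ≢ x′ → I x y → I x′ y → I x y′ → I x′ y′ → y ≡ y′

  -- From a flag i₀ in S, pairing gives flags j (same point, another line) and k (same line,
  -- another point), then l (on the line of j) and m (on the point of k); among four flags
  -- l and m must coincide, which closes a quadrangle.
  paired-flags-empty : NoQuadrangle → (S : Fin 4 → Set) (X : Fin 4 → A) (Y : Fin 4 → B) →
    (∀ i → I (X i) (Y i)) → (∀ {i j} → i ≢ j → X i ≡ X j → Y i ≢ Y j) →
    Paired S X → Paired S Y → ∀ i → ¬ S i
  paired-flags-empty noQuadrangle S X Y flag distinct pairX pairY i₀ Sᵢ₀
    with pairX i₀ Sᵢ₀ | pairY i₀ Sᵢ₀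
  ... | j , j≢i₀ , Xⱼ≡Xᵢ₀ , Sⱼ | k , k≢i₀ , Yₖ≡Yᵢ₀ , Sₖ
    with pairY j Sⱼ | pairX k Sₖ
  ... | l , l≢j , Yₗ≡Yⱼ , _ | m , m≢k , Xₘ≡Xₖ , _ = Yⱼ≢Yᵢ₀ (sym (noQuadrangle Xᵢ₀≢Xₖ
          (flag i₀)
          (subst (I (X k)) Yₖ≡Yᵢ₀ (flag k))
          (subst (λ x → I x (Y j)) Xⱼ≡Xᵢ₀ (flag j))
          (subst₂ I Xₘ≡Xₖ (trans (cong Y m≡l) Yₗ≡Yⱼ) (flag m))))
    where
    Yⱼ≢Yᵢ₀ : Y j ≢ Y i₀
    Yⱼ≢Yᵢ₀ = distinct j≢i₀ Xⱼ≡Xᵢ₀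
    Xₖ≢Xᵢ₀ : X k ≢ X i₀
    Xₖ≢Xᵢ₀ Xₖ≡Xᵢ₀ = distinct k≢i₀ Xₖ≡Xᵢ₀ Yₖ≡Yᵢ₀
    Xᵢ₀≢Xₖ : X i₀ ≢ X k
    Xᵢ₀≢Xₖ = Xₖ≢Xᵢ₀ ∘ sym
    m≡l : m ≡ l
    m≡l = avoid-three-unique i₀ j k m l
      (j≢i₀ ∘ sym) (k≢i₀ ∘ sym) (λ j≡k → Xₖ≢Xᵢ₀ (trans (cong X (sym j≡k)) Xⱼ≡Xᵢ₀))
      (λ m≡i₀ → Xₖ≢Xᵢ₀ (trans (sym Xₘ≡Xₖ) (cong X m≡i₀)))
      (λ m≡j → Xₖ≢Xᵢ₀ (trans (sym Xₘ≡Xₖ) (trans (cong X m≡j) Xⱼ≡Xᵢ₀)))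
      m≢k
      (λ l≡i₀ → Yⱼ≢Yᵢ₀ (trans (sym Yₗ≡Yⱼ) (cong Y l≡i₀)))
      l≢j
      (λ l≡k → Yⱼ≢Yᵢ₀ (trans (sym Yₗ≡Yⱼ) (trans (cong Y l≡k) Yₖ≡Yᵢ₀)))

-- The ring solver needs coefficients with decidable equality; ℤ maps into every commutative ring.
module IntegerRingSolver {c ℓ} (R : CommutativeRing c ℓ) where
  open CommutativeRing R
    renaming (refl to ≈-refl; sym to ≈-sym; trans to ≈-trans; reflexive to ≈-reflexive)
  open RingProperties ring using (-0#≈0#; -‿involutive; -‿+-comm; -‿distribˡ-*; -‿distribʳ-*)
  open SemiringMult semiring using (1+×; ×-homo-+; ×1-homo-*) renaming (_×_ to _×′_)
  open import Relation.Binary.Reasoning.Setoid setoid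

  ⟦_⟧ : ℤ → Carrier
  ⟦ ℤ.+ n ⟧    = n ×′ 1#
  ⟦ -[1+ n ] ⟧ = - (suc n ×′ 1#)

  ⟦⟧-cong : ∀ {i j} → i ≡ j → ⟦ i ⟧ ≈ ⟦ j ⟧
  ⟦⟧-cong e = ≈-reflexive (cong ⟦_⟧ e)

  ⊖-homo : ∀ m n → ⟦ m ⊖ n ⟧ ≈ m ×′ 1# + - (n ×′ 1#)
  ⊖-homo m       zero    = begin
    ⟦ m ⊖ 0 ⟧            ≈⟨ ⟦⟧-cong (ℤP.⊖-≥ {m} ℕ.z≤n) ⟩
    m ×′ 1#              ≈⟨ +-identityʳ _ ⟨
    m ×′ 1# + 0#         ≈⟨ +-congˡ -0#≈0# ⟨
    m ×′ 1# + - 0#       ∎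
  ⊖-homo zero    (suc n) = ≈-sym (+-identityˡ _)
  ⊖-homo (suc m) (suc n) = begin
    ⟦ suc m ⊖ suc n ⟧                  ≈⟨ ⟦⟧-cong (ℤP.[1+m]⊖[1+n]≡m⊖n m n) ⟩
    ⟦ m ⊖ n ⟧                          ≈⟨ ⊖-homo m n ⟩
    m ×′ 1# + - (n ×′ 1#)              ≈⟨ cancel-1 (m ×′ 1#) (n ×′ 1#) ⟨
    (1# + m ×′ 1#) + - (1# + n ×′ 1#)  ≈⟨ +-cong (1+× m 1#) (-‿cong (1+× n 1#)) ⟨
    suc m ×′ 1# + - (suc n ×′ 1#)      ∎
    where
    cancel-1 : ∀ a b → (1# + a) + - (1# + b) ≈ a + - b
    cancel-1 a b = begin
      (1# + a) + - (1# + b)    ≈⟨ +-congˡ (-‿+-comm 1# b) ⟨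
      (1# + a) + (- 1# + - b)  ≈⟨ +-assoc 1# a _ ⟩
      1# + (a + (- 1# + - b))  ≈⟨ +-congˡ (+-assoc a _ _) ⟨
      1# + ((a + - 1#) + - b)  ≈⟨ +-congˡ (+-congʳ (+-comm a _)) ⟩
      1# + ((- 1# + a) + - b)  ≈⟨ +-congˡ (+-assoc _ a _) ⟩
      1# + (- 1# + (a + - b))  ≈⟨ +-assoc _ _ _ ⟨
      (1# + - 1#) + (a + - b)  ≈⟨ +-congʳ (-‿inverseʳ 1#) ⟩
      0# + (a + - b)           ≈⟨ +-identityˡ _ ⟩
      a + - b                  ∎

  +-homo : ∀ i j → ⟦ i ℤ.+ j ⟧ ≈ ⟦ i ⟧ + ⟦ j ⟧
  +-homo -[1+ m ] -[1+ n ] = begin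
    - (suc (suc (m ℕ.+ n)) ×′ 1#)      ≈⟨ -‿cong (≈-reflexive (cong (λ k → suc k ×′ 1#) (ℕP.+-suc m n))) ⟨
    - ((suc m ℕ.+ suc n) ×′ 1#)        ≈⟨ -‿cong (×-homo-+ 1# (suc m) (suc n)) ⟩
    - (suc m ×′ 1# + suc n ×′ 1#)       ≈⟨ -‿+-comm _ _ ⟨
    - (suc m ×′ 1#) + - (suc n ×′ 1#)   ∎
  +-homo -[1+ m ] (ℤ.+ n)  = ≈-trans (⊖-homo n (suc m)) (+-comm _ _)
  +-homo (ℤ.+ m) -[1+ n ]  = ⊖-homo m (suc n)
  +-homo (ℤ.+ m) (ℤ.+ n)   = ×-homo-+ 1# m n

  -‿homo : ∀ i → ⟦ ℤ.- i ⟧ ≈ - ⟦ i ⟧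
  -‿homo (ℤ.+ zero)  = ≈-sym -0#≈0#
  -‿homo (ℤ.+ suc n) = ≈-refl
  -‿homo -[1+ n ]    = ≈-sym (-‿involutive _)

  +*-homo : ∀ m j → ⟦ ℤ.+ m ℤ.* j ⟧ ≈ ⟦ ℤ.+ m ⟧ * ⟦ j ⟧
  +*-homo m (ℤ.+ n)   = ≈-trans (⟦⟧-cong (sym (ℤP.pos-* m n))) (×1-homo-* m n)
  +*-homo m -[1+ n ] = begin
    ⟦ ℤ.+ m ℤ.* ℤ.- ℤ.+ suc n ⟧    ≈⟨ ⟦⟧-cong (ℤP.neg-distribʳ-* (ℤ.+ m) (ℤ.+ suc n)) ⟨
    ⟦ ℤ.- (ℤ.+ m ℤ.* ℤ.+ suc n) ⟧  ≈⟨ -‿homo (ℤ.+ m ℤ.* ℤ.+ suc n) ⟩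
    - ⟦ ℤ.+ m ℤ.* ℤ.+ suc n ⟧      ≈⟨ -‿cong (+*-homo m (ℤ.+ suc n)) ⟩
    - (⟦ ℤ.+ m ⟧ * ⟦ ℤ.+ suc n ⟧)  ≈⟨ -‿distribʳ-* _ _ ⟩
    ⟦ ℤ.+ m ⟧ * - ⟦ ℤ.+ suc n ⟧    ∎

  *-homo : ∀ i j → ⟦ i ℤ.* j ⟧ ≈ ⟦ i ⟧ * ⟦ j ⟧
  *-homo (ℤ.+ m)   j = +*-homo m j
  *-homo -[1+ m ] j = begin
    ⟦ ℤ.- ℤ.+ suc m ℤ.* j ⟧     ≈⟨ ⟦⟧-cong (ℤP.neg-distribˡ-* (ℤ.+ suc m) j) ⟨
    ⟦ ℤ.- (ℤ.+ suc m ℤ.* j) ⟧   ≈⟨ -‿homo (ℤ.+ suc m ℤ.* j) ⟩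
    - ⟦ ℤ.+ suc m ℤ.* j ⟧       ≈⟨ -‿cong (+*-homo (suc m) j) ⟩
    - (⟦ ℤ.+ suc m ⟧ * ⟦ j ⟧)   ≈⟨ -‿distribˡ-* _ _ ⟩
    - ⟦ ℤ.+ suc m ⟧ * ⟦ j ⟧     ∎

  almostCommutativeRing : AlmostCommutativeRing c ℓ
  almostCommutativeRing = ACR.fromCommutativeRing R

  homomorphism : ℤ.+-*-rawRing ACR.-Raw-AlmostCommutative⟶ almostCommutativeRing
  homomorphism = record { ⟦_⟧ = ⟦_⟧ ; +-homo = +-homo ; *-homo = *-homo ; -‿homo = -‿homo
                        ; 0-homo = ≈-refl ; 1-homo = ≈-refl }

  ⟦⟧-cong? : ∀ i j → Maybe (⟦ i ⟧ ≈ ⟦ j ⟧)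
  ⟦⟧-cong? i j = Maybe.map ⟦⟧-cong (dec⇒maybe (i ℤ.≟ j))

  open import Algebra.Solver.Ring ℤ.+-*-rawRing almostCommutativeRing homomorphism ⟦⟧-cong? public
    using (solve; _:=_; _:+_; _:*_; _:-_; :-_; con)

module FieldProperties {q : ℕ} (F : FiniteField q) where
  open FiniteField F public
  open LinAlg F public

  commutativeRing : CommutativeRing 0ℓ 0ℓ
  commutativeRing = record { isCommutativeRing = isCommutativeRing }

  open CommutativeRing commutativeRing public
    using (+-identityˡ; +-identityʳ; -‿inverseʳ; *-assoc; *-comm; *-identityˡ; *-identityʳ;
           zeroˡ; zeroʳ; ring; semiring; +-commutativeMonoid)
  open RingProperties ring public using (-0#≈0#; -‿involutive)
  open IntegerRingSolver commutativeRing public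
  open CommutativeMonoidSum +-commutativeMonoid public
    using (sum; sum-remove; sum-cong-≗; sum-replicate-zero; ∑-comm)
  open SemiringSum semiring public using (*-distribˡ-sum; *-distribʳ-sum)

  private module E = Inverse enumeration

  infix 4 _≟_
  _≟_ : DecidableEquality Carrier
  x ≟ y = map′ (λ e → trans (sym (E.strictlyInverseˡ x)) (trans (cong E.to e) (E.strictlyInverseˡ y)))
               (cong E.from) (E.from x Fin.≟ E.from y)

  elements : List Carrier
  elements = List.tabulate E.to

  length-elements : length elements ≡ q
  length-elements = ListP.length-tabulate E.to

  elements-unique : Unique elements
  elements-unique = UniqueP.tabulate⁺ λ {i} {j} e →
    trans (sym (E.strictlyInverseʳ i)) (trans (cong E.from e) (E.strictlyInverseʳ j))

  ∈-elements : ∀ x → x ∈ elements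
  ∈-elements x = subst (_∈ elements) (E.strictlyInverseˡ x) (MemP.∈-tabulate⁺ (E.from x))

  1#≢0# : 1# ≢ 0#
  1#≢0# e = 0≢1 (sym e)

  _⁻¹⟨_⟩ : (x : Carrier) → x ≢ 0# → Carrier
  x ⁻¹⟨ x≢0 ⟩ = proj₁ (inverse x x≢0)

  x*x⁻¹≡1 : ∀ x (x≢0 : x ≢ 0#) → x * x ⁻¹⟨ x≢0 ⟩ ≡ 1#
  x*x⁻¹≡1 x x≢0 = proj₂ (inverse x x≢0)

  x⁻¹*x≡1 : ∀ x (x≢0 : x ≢ 0#) → x ⁻¹⟨ x≢0 ⟩ * x ≡ 1#
  x⁻¹*x≡1 x x≢0 = trans (*-comm _ _) (x*x⁻¹≡1 x x≢0)

  *-cancelˡ-≡0 : ∀ {x y} → x ≢ 0# → x * y ≡ 0# → y ≡ 0#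
  *-cancelˡ-≡0 {x} {y} x≢0 xy≡0 = begin
    y                ≡⟨ *-identityˡ y ⟨
    1# * y           ≡⟨ cong (_* y) (x⁻¹*x≡1 x x≢0) ⟨
    (x′ * x) * y     ≡⟨ *-assoc x′ x y ⟩
    x′ * (x * y)     ≡⟨ cong (x′ *_) xy≡0 ⟩
    x′ * 0#          ≡⟨ zeroʳ x′ ⟩
    0#               ∎
    where
    open ≡-Reasoning
    x′ = x ⁻¹⟨ x≢0 ⟩

  *-≢0 : ∀ {x y} → x ≢ 0# → y ≢ 0# → x * y ≢ 0#
  *-≢0 x≢0 y≢0 xy≡0 = y≢0 (*-cancelˡ-≡0 x≢0 xy≡0)

  x⁻¹≢0 : ∀ x (x≢0 : x ≢ 0#) → x ⁻¹⟨ x≢0 ⟩ ≢ 0#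
  x⁻¹≢0 x x≢0 x⁻¹≡0 = 1#≢0# (trans (sym (x*x⁻¹≡1 x x≢0)) (trans (cong (x *_) x⁻¹≡0) (zeroʳ x)))

  x+y≡0⇒x≡-y : ∀ {x y} → x + y ≡ 0# → x ≡ - y
  x+y≡0⇒x≡-y {x} {y} x+y≡0 = begin
    x               ≡⟨ solve 2 (λ x y → x := (x :+ y) :- y) refl x y ⟩
    (x + y) + - y   ≡⟨ cong (_+ - y) x+y≡0 ⟩
    0# + - y        ≡⟨ +-identityˡ _ ⟩
    - y             ∎
    where open ≡-Reasoning

  x-y≡0⇒x≡y : ∀ {x y} → x + - y ≡ 0# → x ≡ y
  x-y≡0⇒x≡y {y = y} x-y≡0 = trans (x+y≡0⇒x≡-y x-y≡0) (-‿involutive y)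

  *-cancelˡ-≡ : ∀ {a x y} → a ≢ 0# → a * x ≡ a * y → x ≡ y
  *-cancelˡ-≡ {a} {x} {y} a≢0 ax≡ay = x-y≡0⇒x≡y (*-cancelˡ-≡0 a≢0 (begin
    a * (x + - y)        ≡⟨ solve 3 (λ a x y → a :* (x :- y) := a :* x :- a :* y) refl a x y ⟩
    a * x + - (a * y)    ≡⟨ cong (λ z → z + - (a * y)) ax≡ay ⟩
    a * y + - (a * y)    ≡⟨ -‿inverseʳ _ ⟩
    0#                   ∎))
    where open ≡-Reasoning

  sum-≡0 : ∀ {m} (f : Fin m → Carrier) → (∀ i → f i ≡ 0#) → sum f ≡ 0#
  sum-≡0 {m} f f≡0 = trans (sum-cong-≗ f≡0) (sum-replicate-zero m)

  LinRelation : ∀ {m n} → (Fin m → Vec n) → (Fin m → Carrier) → Set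
  LinRelation u c = ∀ k → sum (λ i → c i * u i k) ≡ 0#

  LinDep : ∀ {m n} → (Fin m → Vec n) → Set
  LinDep u = ∃[ c ] (∃[ i ] c i ≢ 0#) × LinRelation u c

  sum-*-minus-* : ∀ {m} (a v e : Fin m → Carrier) x →
    sum (λ j → a j * (v j + - (e j * x))) ≡ - sum (λ j → a j * e j) * x + sum (λ j → a j * v j)
  sum-*-minus-* {zero}  a v e x = solve 1 (λ x → con (ℤ.+ 0) := :- con (ℤ.+ 0) :* x :+ con (ℤ.+ 0)) refl x
  sum-*-minus-* {suc m} a v e x = begin
    a₀ * (v₀ + - (e₀ * x)) + sum (λ j → a (suc j) * (v (suc j) + - (e (suc j) * x)))
      ≡⟨ cong (a₀ * (v₀ + - (e₀ * x)) +_) (sum-*-minus-* (a ∘ suc) (v ∘ suc) (e ∘ suc) x) ⟩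
    a₀ * (v₀ + - (e₀ * x)) + (- S * x + T)
      ≡⟨ solve 6 (λ a₀ v₀ e₀ x S T → a₀ :* (v₀ :- e₀ :* x) :+ (:- S :* x :+ T)
                   := :- (a₀ :* e₀ :+ S) :* x :+ (a₀ :* v₀ :+ T)) refl a₀ v₀ e₀ x S T ⟩
    - (a₀ * e₀ + S) * x + (a₀ * v₀ + T)  ∎
    where
    open ≡-Reasoning
    a₀ = a zero
    v₀ = v zero
    e₀ = e zero
    S = sum (λ j → a (suc j) * e (suc j))
    T = sum (λ j → a (suc j) * v (suc j))

  -- Adding the pivot row p, with the coefficient that undoes the row operations, turns a relation
  -- among the reduced rows into one among the original rows.
  LinRelation-pivot : ∀ {m n} (u : Fin (suc m) → Vec n) (p : Fin (suc m)) (e c′ : Fin m → Carrier) →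
    LinRelation (λ j k → u (punchIn p j) k + - (e j * u p k)) c′ →
    LinRelation u (insertAt c′ p (- sum (λ j → c′ j * e j)))
  LinRelation-pivot u p e c′ rel′ k = begin
    sum (λ i → c i * u i k)
      ≡⟨ sum-remove {i = p} (λ i → c i * u i k) ⟩
    c p * u p k + sum (λ j → c (punchIn p j) * u (punchIn p j) k)
      ≡⟨ cong₂ _+_ (cong (_* u p k) (insertAt-lookup c′ p (- S)))
                   (sum-cong-≗ (λ j → cong (_* u (punchIn p j) k) (insertAt-punchIn c′ p (- S) j))) ⟩
    - S * u p k + sum (λ j → c′ j * u (punchIn p j) k)
      ≡⟨ sum-*-minus-* c′ (λ j → u (punchIn p j) k) e (u p k) ⟨
    sum (λ j → c′ j * (u (punchIn p j) k + - (e j * u p k)))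
      ≡⟨ rel′ k ⟩
    0#  ∎
    where
    open ≡-Reasoning
    S = sum (λ j → c′ j * e j)
    c = insertAt c′ p (- S)

  -- Gaussian elimination: a pivot row clears the first coordinate of the other rows.
  n<m⇒LinDep : ∀ {n m} → n ℕ.< m → (u : Fin m → Vec n) → LinDep u
  n<m⇒LinDep {zero} {suc m} _ u = (λ { zero → 1# ; (suc _) → 0# }) , (zero , 1#≢0#) , λ ()
  n<m⇒LinDep {suc n} {suc m} (ℕ.s≤s n<m) u with FinP.any? (λ i → ¬? (u i zero ≟ 0#))
  ... | no no-pivot = c , nontrivial , rel
    where
    column₀≡0 : ∀ i → u i zero ≡ 0#
    column₀≡0 i = decidable-stable (u i zero ≟ 0#) (λ u≢0 → no-pivot (i , u≢0))
    r = n<m⇒LinDep (ℕP.m<n⇒m<1+n n<m) (λ i k → u i (suc k))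
    c = proj₁ r
    nontrivial = proj₁ (proj₂ r)
    rel : LinRelation u c
    rel zero    = sum-≡0 _ (λ i → trans (cong (c i *_) (column₀≡0 i)) (zeroʳ _))
    rel (suc k) = proj₂ (proj₂ r) k
  ... | yes (p , d≢0) = insertAt c′ p _ , (punchIn p j₀ , nontrivial) , LinRelation-pivot u p e c′ rel′
    where
    d = u p zero
    e : Fin m → Carrier
    e j = u (punchIn p j) zero * d ⁻¹⟨ d≢0 ⟩
    reduced : Fin m → Vec (suc n)
    reduced j k = u (punchIn p j) k + - (e j * u p k)
    reduced₀≡0 : ∀ j → reduced j zero ≡ 0#
    reduced₀≡0 j = begin
      w + - (w * d ⁻¹⟨ d≢0 ⟩ * d)    ≡⟨ cong (λ z → w + - z) (*-assoc w _ d) ⟩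
      w + - (w * (d ⁻¹⟨ d≢0 ⟩ * d))  ≡⟨ cong (λ z → w + - (w * z)) (x⁻¹*x≡1 d d≢0) ⟩
      w + - (w * 1#)                 ≡⟨ cong (λ z → w + - z) (*-identityʳ w) ⟩
      w + - w                        ≡⟨ -‿inverseʳ w ⟩
      0#                             ∎
      where
      open ≡-Reasoning
      w = u (punchIn p j) zero
    r = n<m⇒LinDep n<m (λ j k → reduced j (suc k))
    c′ = proj₁ r
    j₀ = proj₁ (proj₁ (proj₂ r))
    nontrivial : insertAt c′ p (- sum (λ j → c′ j * e j)) (punchIn p j₀) ≢ 0#
    nontrivial c≡0 = proj₂ (proj₁ (proj₂ r)) (trans (sym (insertAt-punchIn c′ p _ j₀)) c≡0)
    rel′ : LinRelation reduced c′
    rel′ zero    = sum-≡0 _ (λ j → trans (cong (c′ j *_) (reduced₀≡0 j)) (zeroʳ _))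
    rel′ (suc k) = proj₂ (proj₂ r) k

  Combination : ∀ {m n} → Vec n → (Fin m → Vec n) → Set
  Combination {m} v B = Σ (Vec m) λ s → ∀ k → v k ≡ sum (λ t → s t * B t k)

  LinRelation-combine : ∀ {l m n} {s : Fin l → Vec m} {c} (B : Fin m → Vec n) (u : Fin l → Vec n) →
    LinRelation s c → (∀ i k → u i k ≡ sum (λ t → s i t * B t k)) → LinRelation u c
  LinRelation-combine {l} {m} {s = s} {c} B u rel u≡sB k = begin
    sum (λ i → c i * u i k)
      ≡⟨ sum-cong-≗ (λ i → trans (cong (c i *_) (u≡sB i k)) (*-distribˡ-sum {m} (c i) _)) ⟩
    sum (λ (i : Fin l) → sum (λ (t : Fin m) → c i * (s i t * B t k)))
      ≡⟨ ∑-comm (λ i t → c i * (s i t * B t k)) ⟩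
    sum (λ (t : Fin m) → sum (λ (i : Fin l) → c i * (s i t * B t k)))
      ≡⟨ sum-cong-≗ (λ t → trans (sum-cong-≗ {l} (λ i → sym (*-assoc (c i) _ _)))
                                 (sym (*-distribʳ-sum {l} (B t k) _))) ⟩
    sum (λ (t : Fin m) → sum (λ (i : Fin l) → c i * s i t) * B t k)
      ≡⟨ sum-≡0 _ (λ t → trans (cong (_* B t k) (rel t)) (zeroˡ _)) ⟩
    0#  ∎
    where open ≡-Reasoning

  combinations-LinDep : ∀ {l m n} → m ℕ.< l → (B : Fin m → Vec n) (u : Fin l → Vec n) →
    (∀ i → Combination (u i) B) → LinDep u
  combinations-LinDep m<l B u u∈⟨B⟩ =
    let c , nontrivial , rel = n<m⇒LinDep m<l (λ i → proj₁ (u∈⟨B⟩ i))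
    in  c , nontrivial , LinRelation-combine B u rel (λ i → proj₂ (u∈⟨B⟩ i))

  ∼-refl : ∀ {n} (v : Vec n) → v ∼ v
  ∼-refl v = 1# , 1#≢0# , λ i → sym (*-identityˡ _)

  ∼-sym : ∀ {n} {v w : Vec n} → v ∼ w → w ∼ v
  ∼-sym {v = v} {w} (c , c≢0 , v≡cw) = c ⁻¹⟨ c≢0 ⟩ , x⁻¹≢0 c c≢0 , λ i → begin
    w i                       ≡⟨ *-identityˡ _ ⟨
    1# * w i                  ≡⟨ cong (_* w i) (x⁻¹*x≡1 c c≢0) ⟨
    (c ⁻¹⟨ c≢0 ⟩ * c) * w i   ≡⟨ *-assoc _ _ _ ⟩
    c ⁻¹⟨ c≢0 ⟩ * (c * w i)   ≡⟨ cong (c ⁻¹⟨ c≢0 ⟩ *_) (v≡cw i) ⟨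
    c ⁻¹⟨ c≢0 ⟩ * v i         ∎
    where open ≡-Reasoning

  ∼-trans : ∀ {n} {u v w : Vec n} → u ∼ v → v ∼ w → u ∼ w
  ∼-trans (c , c≢0 , u≡cv) (d , d≢0 , v≡dw) = c * d , *-≢0 c≢0 d≢0 ,
    λ i → trans (u≡cv i) (trans (cong (c *_) (v≡dw i)) (sym (*-assoc c d _)))

  InSpan2-resp-∼ : ∀ {n} {v w a b : Vec n} → v ∼ w → InSpan2 w a b → InSpan2 v a b
  InSpan2-resp-∼ {a = a} {b} (c , _ , v≡cw) (s , t , w≡sa+tb) = c * s , c * t , λ i →
    trans (v≡cw i) (trans (cong (c *_) (w≡sa+tb i))
      (solve 5 (λ c s t x y → c :* (s :* x :+ t :* y) := c :* s :* x :+ c :* t :* y) refl c s t (a i) (b i)))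

  InSpan2-trans : ∀ {n} {v a b a′ b′ : Vec n} →
    InSpan2 v a b → InSpan2 a a′ b′ → InSpan2 b a′ b′ → InSpan2 v a′ b′
  InSpan2-trans {a′ = a′} {b′} (s , t , v≡) (s₁ , t₁ , a≡) (s₂ , t₂ , b≡) =
    s * s₁ + t * s₂ , s * t₁ + t * t₂ , λ i →
      trans (v≡ i) (trans (cong₂ (λ x y → s * x + t * y) (a≡ i) (b≡ i))
        (solve 8 (λ s t s₁ t₁ s₂ t₂ x y → s :* (s₁ :* x :+ t₁ :* y) :+ t :* (s₂ :* x :+ t₂ :* y)
                    := (s :* s₁ :+ t :* s₂) :* x :+ (s :* t₁ :+ t :* t₂) :* y)
                 refl s t s₁ t₁ s₂ t₂ (a′ i) (b′ i)))

  InSpan2? : ∀ {n} (v a b : Vec n) → Dec (InSpan2 v a b)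
  InSpan2? v a b = map′
    (λ (i , j , v≡) → E.to i , E.to j , v≡)
    (λ (s , t , v≡) → E.from s , E.from t , λ k → trans (v≡ k)
        (cong₂ (λ x y → x * a k + y * b k) (sym (E.strictlyInverseˡ s)) (sym (E.strictlyInverseˡ t))))
    (FinP.any? λ i → FinP.any? λ j → FinP.all? λ k → v k ≟ E.to i * a k + E.to j * b k)

  NonZeroV? : ∀ {n} (v : Vec n) → Dec (NonZeroV v)
  NonZeroV? v = ¬? (FinP.all? (λ i → v i ≟ 0#))

  nonzero-≁⇒LinIndep2 : ∀ {n} {p p′ : Vec n} → NonZeroV p → NonZeroV p′ → ¬ p ∼ p′ → LinIndep2 p p′
  nonzero-≁⇒LinIndep2 {p = p} {p′} p≢0 p′≢0 p≁p′ s t sp+tp′≡0 with s ≟ 0#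
  ... | yes s≡0 = s≡0 , decidable-stable (t ≟ 0#) t≢0⇒p′≡0
    where
    t≢0⇒p′≡0 : t ≢ 0# → ⊥
    t≢0⇒p′≡0 t≢0 = p′≢0 λ i → *-cancelˡ-≡0 t≢0 (begin
      t * p′ i             ≡⟨ +-identityˡ _ ⟨
      0# + t * p′ i        ≡⟨ cong (λ z → z + t * p′ i) (trans (cong (_* p i) s≡0) (zeroˡ _)) ⟨
      s * p i + t * p′ i   ≡⟨ sp+tp′≡0 i ⟩
      0#                   ∎)
      where open ≡-Reasoning
  ... | no s≢0 = ⊥-elim (p≁p′ (u , u≢0 , p≡up′))
    where
    u = - (t * s ⁻¹⟨ s≢0 ⟩)
    p≡up′ : ∀ i → p i ≡ u * p′ i
    p≡up′ i = *-cancelˡ-≡ s≢0 (begin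
      s * p i                            ≡⟨ x+y≡0⇒x≡-y (sp+tp′≡0 i) ⟩
      - (t * p′ i)                       ≡⟨ *-identityʳ _ ⟨
      - (t * p′ i) * 1#                  ≡⟨ cong (- (t * p′ i) *_) (x*x⁻¹≡1 s s≢0) ⟨
      - (t * p′ i) * (s * s ⁻¹⟨ s≢0 ⟩)   ≡⟨ solve 4 (λ t x s s′ → :- (t :* x) :* (s :* s′) := s :* (:- (t :* s′) :* x))
                                               refl t (p′ i) s (s ⁻¹⟨ s≢0 ⟩) ⟩
      s * (u * p′ i)                     ∎)
      where open ≡-Reasoning
    u≢0 : u ≢ 0#
    u≢0 u≡0 = p≢0 λ i → trans (p≡up′ i) (trans (cong (_* p′ i) u≡0) (zeroˡ _))

  InSpan2⇒Combination : ∀ {n} {v a b : Vec n} → InSpan2 v a b → Combination v (pair a b)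
  InSpan2⇒Combination {a = a} (s , t , v≡) =
    pair s t , λ k → trans (v≡ k) (cong (s * a k +_) (sym (+-identityʳ _)))

  -- Two independent vectors of a plane ⟨a, b⟩ span it: (p, p′, v) are three vectors in a
  -- two-dimensional space, and the coefficient of v in their relation cannot vanish.
  InSpan2-basis-change : ∀ {n} {p p′ a b v : Vec n} → LinIndep2 p p′ →
    InSpan2 p a b → InSpan2 p′ a b → InSpan2 v a b → InSpan2 v p p′
  InSpan2-basis-change {n} {p} {p′} {a} {b} {v} p⊥p′ p∈ p′∈ v∈ = from-relation
    (combinations-LinDep (ℕ.s≤s (ℕ.s≤s (ℕ.s≤s ℕ.z≤n))) (pair a b) u
       (λ { zero → InSpan2⇒Combination p∈ ; (suc zero) → InSpan2⇒Combination p′∈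
          ; (suc (suc zero)) → InSpan2⇒Combination v∈ }))
    where
    u : Fin 3 → Vec n
    u = triple p p′ v

    v-coefficient≢0 : ∀ {c} → ∃[ i ] c i ≢ 0# → LinRelation u c → c (suc (suc zero)) ≢ 0#
    v-coefficient≢0 {c} (i , cᵢ≢0) rel c₂≡0 = trivial i cᵢ≢0
      where
      c₀,c₁≡0 = p⊥p′ (c zero) (c (suc zero)) λ k → begin
        c zero * p k + c (suc zero) * p′ k
          ≡⟨ solve 3 (λ x y z → x :+ y := x :+ (y :+ (con (ℤ.+ 0) :* z :+ con (ℤ.+ 0)))) refl _ _ (v k) ⟩
        c zero * p k + (c (suc zero) * p′ k + (0# * v k + 0#))
          ≡⟨ cong (λ z → c zero * p k + (c (suc zero) * p′ k + (z * v k + 0#))) c₂≡0 ⟨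
        c zero * p k + (c (suc zero) * p′ k + (c (suc (suc zero)) * v k + 0#))
          ≡⟨ rel k ⟩
        0#  ∎
        where open ≡-Reasoning
      trivial : ∀ i → c i ≢ 0# → ⊥
      trivial zero             c≢0 = c≢0 (proj₁ c₀,c₁≡0)
      trivial (suc zero)       c≢0 = c≢0 (proj₂ c₀,c₁≡0)
      trivial (suc (suc zero)) c≢0 = c≢0 c₂≡0

    from-relation : LinDep u → InSpan2 v p p′
    from-relation (c , nontrivial , rel) = - (c₀ * c₂′) , - (c₁ * c₂′) , λ k → begin
      v k
        ≡⟨ *-identityˡ (v k) ⟨
      1# * v k
        ≡⟨ cong (_* v k) (x⁻¹*x≡1 c₂ c₂≢0) ⟨
      c₂′ * c₂ * v k
        ≡⟨ solve 3 (λ c₂ c₂′ z → c₂′ :* c₂ :* z := c₂′ :* c₂ :* z :- c₂′ :* con (ℤ.+ 0)) refl c₂ c₂′ (v k) ⟩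
      c₂′ * c₂ * v k + - (c₂′ * 0#)
        ≡⟨ cong (λ z → c₂′ * c₂ * v k + - (c₂′ * z)) (rel k) ⟨
      c₂′ * c₂ * v k + - (c₂′ * (c₀ * p k + (c₁ * p′ k + (c₂ * v k + 0#))))
        ≡⟨ solve 7 (λ c₀ c₁ c₂ c₂′ x y z →
                      c₂′ :* c₂ :* z :- c₂′ :* (c₀ :* x :+ (c₁ :* y :+ (c₂ :* z :+ con (ℤ.+ 0))))
                      := :- (c₀ :* c₂′) :* x :+ :- (c₁ :* c₂′) :* y)
                 refl c₀ c₁ c₂ c₂′ (p k) (p′ k) (v k) ⟩
      - (c₀ * c₂′) * p k + - (c₁ * c₂′) * p′ k  ∎
      where
      open ≡-Reasoning
      c₀ = c zero
      c₁ = c (suc zero)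
      c₂ = c (suc (suc zero))
      c₂≢0 = v-coefficient≢0 nontrivial rel
      c₂′ = c₂ ⁻¹⟨ c₂≢0 ⟩

  InSpan2-left : ∀ {n} (a b : Vec n) → InSpan2 a a b
  InSpan2-left a b = 1# , 0# , λ i → solve 2 (λ x y → x := con (ℤ.+ 1) :* x :+ con (ℤ.+ 0) :* y) refl (a i) (b i)

  InSpan2-right : ∀ {n} (a b : Vec n) → InSpan2 b a b
  InSpan2-right a b = 0# , 1# , λ i → solve 2 (λ x y → y := con (ℤ.+ 0) :* x :+ con (ℤ.+ 1) :* y) refl (a i) (b i)

  InSpan3⇒Combination : ∀ {n} {v a b c : Vec n} → InSpan3 v a b c → Combination v (triple a b c)
  InSpan3⇒Combination {a = a} {b} {c} (s , t , r , v≡) = triple s t r , λ k → trans (v≡ k)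
    (solve 6 (λ s t r x y z → s :* x :+ t :* y :+ r :* z := s :* x :+ (t :* y :+ (r :* z :+ con (ℤ.+ 0))))
       refl s t r (a k) (b k) (c k))

  Combination-resp-∼ : ∀ {m n} {v w : Vec n} {B : Fin m → Vec n} → v ∼ w → Combination w B → Combination v B
  Combination-resp-∼ {m} {v = v} {w} {B} (c , _ , v≡cw) (s , w≡sB) = (λ t → c * s t) , λ k → begin
    v k                                  ≡⟨ v≡cw k ⟩
    c * w k                              ≡⟨ cong (c *_) (w≡sB k) ⟩
    c * sum (λ t → s t * B t k)          ≡⟨ *-distribˡ-sum {m} c _ ⟩
    sum (λ t → c * (s t * B t k))        ≡⟨ sum-cong-≗ (λ t → sym (*-assoc c (s t) (B t k))) ⟩
    sum (λ t → c * s t * B t k)          ∎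
    where open ≡-Reasoning

  linePoints : ∀ {n} → Vec n → Vec n → List (Vec n)
  linePoints a b = a ∷ map (λ s i → s * a i + b i) elements

  length-linePoints : ∀ {n} (a b : Vec n) → length (linePoints a b) ≡ suc q
  length-linePoints a b = cong suc (trans (ListP.length-map _ elements) length-elements)

  linePoints-nonzero : ∀ {n} {a b : Vec n} → LinIndep2 a b → All NonZeroV (linePoints a b)
  linePoints-nonzero {a = a} {b} a⊥b = a≢0 ∷ AllP.map⁺ (All.universal sa+b≢0 elements)
    where
    a≢0 : NonZeroV a
    a≢0 a≡0 = 1#≢0# (proj₁ (a⊥b 1# 0# λ i → begin
      1# * a i + 0# * b i   ≡⟨ cong (λ z → 1# * z + 0# * b i) (a≡0 i) ⟩
      1# * 0# + 0# * b i    ≡⟨ solve 1 (λ y → con (ℤ.+ 1) :* con (ℤ.+ 0) :+ con (ℤ.+ 0) :* y := con (ℤ.+ 0)) refl (b i) ⟩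
      0#                    ∎))
      where open ≡-Reasoning
    sa+b≢0 : ∀ s → NonZeroV (λ i → s * a i + b i)
    sa+b≢0 s sa+b≡0 = 1#≢0# (proj₂ (a⊥b s 1# λ i → trans (cong (s * a i +_) (*-identityˡ (b i))) (sa+b≡0 i)))

  linePoints-onLine : ∀ {n} (a b : Vec n) → All (λ v → InSpan2 v a b) (linePoints a b)
  linePoints-onLine a b =
    InSpan2-left a b ∷
    AllP.map⁺ (All.universal (λ s → s , 1# , λ i → cong (s * a i +_) (sym (*-identityˡ (b i)))) elements)

  linePoints-distinct : ∀ {n} {a b : Vec n} → LinIndep2 a b → AllPairs (λ v w → ¬ v ∼ w) (linePoints a b)
  linePoints-distinct {a = a} {b} a⊥b =
    AllP.map⁺ (All.universal a≁sa+b elements) ∷ AllPairsP.map⁺ (AllPairs.map sa+b≁s′a+b elements-unique)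
    where
    a≁sa+b : ∀ s → ¬ a ∼ (λ i → s * a i + b i)
    a≁sa+b s (c , c≢0 , a≡c[sa+b]) = c≢0 (proj₂ (a⊥b (c * s + - 1#) c λ i → trans
      (solve 4 (λ s c x y → (c :* s :- con (ℤ.+ 1)) :* x :+ c :* y := c :* (s :* x :+ y) :- x) refl s c (a i) (b i))
      (trans (cong (λ z → c * (s * a i + b i) + - z) (a≡c[sa+b] i)) (-‿inverseʳ _))))
    sa+b≁s′a+b : ∀ {s s′} → s ≢ s′ → ¬ (λ i → s * a i + b i) ∼ (λ i → s′ * a i + b i)
    sa+b≁s′a+b {s} {s′} s≢s′ (c , _ , ≡c[s′a+b]) = s≢s′ (begin
      s        ≡⟨ x-y≡0⇒x≡y (proj₁ coefficients≡0) ⟩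
      c * s′   ≡⟨ cong (_* s′) c≡1 ⟩
      1# * s′  ≡⟨ *-identityˡ s′ ⟩
      s′       ∎)
      where
      open ≡-Reasoning
      coefficients≡0 = a⊥b (s + - (c * s′)) (1# + - c) λ i → trans
        (solve 5 (λ s s′ c x y → (s :- c :* s′) :* x :+ (con (ℤ.+ 1) :- c) :* y
                                  := (s :* x :+ y) :- c :* (s′ :* x :+ y)) refl s s′ c (a i) (b i))
        (trans (cong (λ z → z + - (c * (s′ * a i + b i))) (≡c[s′a+b] i)) (-‿inverseʳ _))
      c≡1 : c ≡ 1#
      c≡1 = sym (x-y≡0⇒x≡y (proj₂ coefficients≡0))

  linePoints-complete : ∀ {n} {a b p : Vec n} → NonZeroV p → InSpan2 p a b → Any (p ∼_) (linePoints a b)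
  linePoints-complete {a = a} {b} {p} p≢0 (s , t , p≡sa+tb) with t ≟ 0#
  ... | yes t≡0 = here (s , s≢0 , p≡sa)
    where
    p≡sa : ∀ i → p i ≡ s * a i
    p≡sa i = trans (p≡sa+tb i) (trans (cong (λ z → s * a i + z * b i) t≡0)
               (solve 2 (λ x y → x :+ con (ℤ.+ 0) :* y := x) refl (s * a i) (b i)))
    s≢0 : s ≢ 0#
    s≢0 s≡0 = p≢0 λ i → trans (p≡sa i) (trans (cong (_* a i) s≡0) (zeroˡ _))
  ... | no t≢0 = there (AnyP.map⁺ (Any.map (λ {r} r≡st′ → t , t≢0 , λ i → trans (p≡sa+tb i) (p≡t[ra+b] r≡st′ i))
                                           (∈-elements (s * t′))))
    where
    t′ = t ⁻¹⟨ t≢0 ⟩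
    p≡t[ra+b] : ∀ {r} → s * t′ ≡ r → ∀ i → s * a i + t * b i ≡ t * (r * a i + b i)
    p≡t[ra+b] refl i = begin
      s * a i + t * b i                  ≡⟨ cong (λ z → z * a i + t * b i) (*-identityʳ s) ⟨
      s * 1# * a i + t * b i             ≡⟨ cong (λ z → s * z * a i + t * b i) (x*x⁻¹≡1 t t≢0) ⟨
      s * (t * t′) * a i + t * b i       ≡⟨ solve 5 (λ s t t′ x y → s :* (t :* t′) :* x :+ t :* y
                                                     := t :* (s :* t′ :* x :+ y)) refl s t t′ (a i) (b i) ⟩
      t * (s * t′ * a i + b i)           ∎
      where open ≡-Reasoning

  moments : Carrier → Vec 4
  moments z zero                   = 1#
  moments z (suc zero)             = z
  moments z (suc (suc zero))       = z * z
  moments z (suc (suc (suc zero))) = z * z * z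

  cubic-coefficients : Carrier → Carrier → Carrier → Fin 4 → Carrier
  cubic-coefficients a b c zero                   = - (a * b * c)
  cubic-coefficients a b c (suc zero)             = a * b + b * c + a * c
  cubic-coefficients a b c (suc (suc zero))       = - (a + b + c)
  cubic-coefficients a b c (suc (suc (suc zero))) = 1#

  cubic-expand : ∀ a b c z →
    (z + - a) * ((z + - b) * (z + - c)) ≡ sum (λ t → moments z t * cubic-coefficients a b c t)
  cubic-expand a b c z = solve 4 (λ a b c z →
    (z :- a) :* ((z :- b) :* (z :- c))
    := con (ℤ.+ 1) :* :- (a :* b :* c) :+ (z :* (a :* b :+ b :* c :+ a :* c)
       :+ (z :* z :* :- (a :+ b :+ c) :+ (z :* z :* z :* con (ℤ.+ 1) :+ con (ℤ.+ 0)))))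
    refl a b c z

  moments-relation-cubic : ∀ {m} (C Z : Fin m → Carrier) → LinRelation (moments ∘ Z) C → ∀ a b c →
    sum (λ i → C i * ((Z i + - a) * ((Z i + - b) * (Z i + - c)))) ≡ 0#
  moments-relation-cubic C Z rel a b c = LinRelation-combine {s = moments ∘ Z} {C}
    (λ t (_ : Fin 1) → cubic-coefficients a b c t) _ rel (λ i _ → cubic-expand a b c (Z i)) zero

  *-product₃-≡0 : ∀ x (f : Fin 3 → Carrier) j → x * f j ≡ 0# →
    x * (f zero * (f (suc zero) * f (suc (suc zero)))) ≡ 0#
  *-product₃-≡0 x f j xfⱼ≡0 = trans (factor-out j) (trans (cong (_* others j) xfⱼ≡0) (zeroˡ _))
    where
    others : Fin 3 → Carrier
    others zero             = f (suc zero) * f (suc (suc zero))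
    others (suc zero)       = f zero * f (suc (suc zero))
    others (suc (suc zero)) = f zero * f (suc zero)
    factor-out : ∀ j → x * (f zero * (f (suc zero) * f (suc (suc zero)))) ≡ x * f j * others j
    factor-out zero             = solve 4 (λ x a b c → x :* (a :* (b :* c)) := x :* a :* (b :* c))
                                    refl x (f zero) (f (suc zero)) (f (suc (suc zero)))
    factor-out (suc zero)       = solve 4 (λ x a b c → x :* (a :* (b :* c)) := x :* b :* (a :* c))
                                    refl x (f zero) (f (suc zero)) (f (suc (suc zero)))
    factor-out (suc (suc zero)) = solve 4 (λ x a b c → x :* (a :* (b :* c)) := x :* c :* (a :* b))
                                    refl x (f zero) (f (suc zero)) (f (suc (suc zero)))

  -- Pair the relation with the cubic whose roots are the other parameters zⱼ (or zᵢ + 1 where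
  -- cⱼ = 0): every term but the i-th vanishes, and that one is cᵢ times a nonzero value.
  moments-relation-isolated : ∀ (C Z : Fin 4 → Carrier) → LinRelation (moments ∘ Z) C → ∀ i →
    (∀ j → Z (punchIn i j) ≡ Z i → C (punchIn i j) ≡ 0#) → C i ≡ 0#
  moments-relation-isolated C Z rel i unpaired =
    *-cancelˡ-≡0 P[Zᵢ]≢0 (trans (*-comm _ _) CᵢP[Zᵢ]≡0)
    where
    root : ∀ {z} → Dec (z ≡ Z i) → Carrier
    root     (yes _) = Z i + 1#
    root {z} (no _)  = z

    r : Fin 3 → Carrier
    r j = root (Z (punchIn i j) ≟ Z i)

    P : Carrier → Carrier
    P z = (z + - r zero) * ((z + - r (suc zero)) * (z + - r (suc (suc zero))))

    Zᵢ-root≢0 : ∀ {z} (d : Dec (z ≡ Z i)) → Z i + - root d ≢ 0#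
    Zᵢ-root≢0 (yes _) Zᵢ-[Zᵢ+1]≡0 = 1#≢0# (trans
      (solve 1 (λ z → con (ℤ.+ 1) := :- (z :- (z :+ con (ℤ.+ 1)))) refl (Z i))
      (trans (cong -_ Zᵢ-[Zᵢ+1]≡0) -0#≈0#))
    Zᵢ-root≢0 (no z≢Zᵢ) Zᵢ-z≡0 = z≢Zᵢ (sym (x-y≡0⇒x≡y Zᵢ-z≡0))

    P[Zᵢ]≢0 : P (Z i) ≢ 0#
    P[Zᵢ]≢0 = *-≢0 (Zᵢ-r≢0 zero) (*-≢0 (Zᵢ-r≢0 (suc zero)) (Zᵢ-r≢0 (suc (suc zero))))
      where
      Zᵢ-r≢0 : ∀ j → Z i + - r j ≢ 0#
      Zᵢ-r≢0 j = Zᵢ-root≢0 (Z (punchIn i j) ≟ Z i)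

    root-kills : ∀ j → C (punchIn i j) * (Z (punchIn i j) + - r j) ≡ 0#
    root-kills j = kills (Z (punchIn i j) ≟ Z i)
      where
      kills : (d : Dec (Z (punchIn i j) ≡ Z i)) → C (punchIn i j) * (Z (punchIn i j) + - root d) ≡ 0#
      kills (yes same) = trans (cong (_* (Z (punchIn i j) + - (Z i + 1#))) (unpaired j same)) (zeroˡ _)
      kills (no _)     = trans (cong (C (punchIn i j) *_) (-‿inverseʳ _)) (zeroʳ _)

    CᵢP[Zᵢ]≡0 : C i * P (Z i) ≡ 0#
    CᵢP[Zᵢ]≡0 = begin
      C i * P (Z i)                                                      ≡⟨ +-identityʳ _ ⟨
      C i * P (Z i) + 0#                                                 ≡⟨ cong (C i * P (Z i) +_) others≡0 ⟨
      C i * P (Z i) + sum (λ j → C (punchIn i j) * P (Z (punchIn i j)))  ≡⟨ sum-remove {i = i} (λ i → C i * P (Z i)) ⟨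
      sum (λ i → C i * P (Z i))                                          ≡⟨ moments-relation-cubic C Z rel _ _ _ ⟩
      0#                                                                 ∎
      where
      open ≡-Reasoning
      others≡0 = sum-≡0 _ λ j → *-product₃-≡0 _ (λ t → Z (punchIn i j) + - r t) j (root-kills j)

  moments-relation-paired : ∀ (C Z : Fin 4 → Carrier) → LinRelation (moments ∘ Z) C → Paired (λ i → C i ≢ 0#) Z
  moments-relation-paired C Z rel i Cᵢ≢0
    with FinP.any? (λ j → (Z (punchIn i j) ≟ Z i) ×-dec ¬? (C (punchIn i j) ≟ 0#))
  ... | yes (j , same , Cⱼ≢0) = punchIn i j , FinP.punchInᵢ≢i i j , same , Cⱼ≢0
  ... | no unpaired = ⊥-elim (Cᵢ≢0 (moments-relation-isolated C Z rel i λ j same →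
                        decidable-stable (C (punchIn i j) ≟ 0#) λ Cⱼ≢0 → unpaired (j , same , Cⱼ≢0)))

module ProjectivePlane {q₀ : ℕ} (K : FiniteField q₀) where
  open FieldProperties K
  open PG2 K using (LineRep; IsLine; OnLine; SameLine)

  common-points-⊆ : ∀ {p p′ v} {ℓ ℓ′ : LineRep} → LinIndep2 p p′ →
    OnLine p ℓ → OnLine p′ ℓ → OnLine p ℓ′ → OnLine p′ ℓ′ → OnLine v ℓ → OnLine v ℓ′
  common-points-⊆ p⊥p′ p∈ℓ p′∈ℓ p∈ℓ′ p′∈ℓ′ v∈ℓ =
    InSpan2-trans (InSpan2-basis-change p⊥p′ p∈ℓ p′∈ℓ v∈ℓ) p∈ℓ′ p′∈ℓ′

  two-points-same-line : ∀ {p p′} {ℓ ℓ′ : LineRep} → LinIndep2 p p′ →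
    OnLine p ℓ → OnLine p′ ℓ → OnLine p ℓ′ → OnLine p′ ℓ′ → SameLine ℓ ℓ′
  two-points-same-line {ℓ = a , b} {a′ , b′} p⊥p′ p∈ℓ p′∈ℓ p∈ℓ′ p′∈ℓ′ =
    (ℓ⊆ℓ′ (InSpan2-left a b) , ℓ⊆ℓ′ (InSpan2-right a b)) ,
    (ℓ′⊆ℓ (InSpan2-left a′ b′) , ℓ′⊆ℓ (InSpan2-right a′ b′))
    where
    ℓ⊆ℓ′ : ∀ {v} → OnLine v (a , b) → OnLine v (a′ , b′)
    ℓ⊆ℓ′ = common-points-⊆ p⊥p′ p∈ℓ p′∈ℓ p∈ℓ′ p′∈ℓ′
    ℓ′⊆ℓ : ∀ {v} → OnLine v (a′ , b′) → OnLine v (a , b)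
    ℓ′⊆ℓ = common-points-⊆ p⊥p′ p∈ℓ′ p′∈ℓ′ p∈ℓ p′∈ℓ

  lines-meet : ∀ {ℓ ℓ′ : LineRep} → IsLine ℓ → IsLine ℓ′ → ∃[ p ] NonZeroV p × OnLine p ℓ × OnLine p ℓ′
  lines-meet {l₁ , l₂} {a , b} l₁⊥l₂ a⊥b with n<m⇒LinDep {3} {4} (ℕ.s≤s (ℕ.s≤s (ℕ.s≤s (ℕ.s≤s ℕ.z≤n))))
                                              (λ { zero → l₁ ; (suc zero) → l₂ ; (suc (suc zero)) → a
                                                 ; (suc (suc (suc zero))) → b })
  ... | c , (i , cᵢ≢0) , rel = p , p≢0 , p∈ℓ , (c₂ , c₃ , λ k → refl)
    where
    c₀ = c zero
    c₁ = c (suc zero)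
    c₂ = c (suc (suc zero))
    c₃ = c (suc (suc (suc zero)))
    p : Vec 3
    p k = c₂ * a k + c₃ * b k
    p∈ℓ : OnLine p (l₁ , l₂)
    p∈ℓ = - c₀ , - c₁ , λ k → begin
      c₂ * a k + c₃ * b k
        ≡⟨ solve 8 (λ c₀ c₁ c₂ c₃ x y z w → c₂ :* z :+ c₃ :* w
                     := :- c₀ :* x :+ :- c₁ :* y :+ (c₀ :* x :+ (c₁ :* y :+ (c₂ :* z :+ (c₃ :* w :+ con (ℤ.+ 0))))))
                 refl c₀ c₁ c₂ c₃ (l₁ k) (l₂ k) (a k) (b k) ⟩
      - c₀ * l₁ k + - c₁ * l₂ k + (c₀ * l₁ k + (c₁ * l₂ k + (c₂ * a k + (c₃ * b k + 0#))))
        ≡⟨ cong (- c₀ * l₁ k + - c₁ * l₂ k +_) (rel k) ⟩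
      - c₀ * l₁ k + - c₁ * l₂ k + 0#
        ≡⟨ +-identityʳ _ ⟩
      - c₀ * l₁ k + - c₁ * l₂ k  ∎
      where open ≡-Reasoning
    p≢0 : NonZeroV p
    p≢0 p≡0 = trivial i cᵢ≢0
      where
      c₂,c₃≡0 = a⊥b c₂ c₃ p≡0
      c₀,c₁≡0 = l₁⊥l₂ c₀ c₁ λ k → begin
        c₀ * l₁ k + c₁ * l₂ k
          ≡⟨ solve 8 (λ c₀ c₁ c₂ c₃ x y z w → c₀ :* x :+ c₁ :* y
                       := (c₀ :* x :+ (c₁ :* y :+ (c₂ :* z :+ (c₃ :* w :+ con (ℤ.+ 0))))) :- (c₂ :* z :+ c₃ :* w))
                   refl c₀ c₁ c₂ c₃ (l₁ k) (l₂ k) (a k) (b k) ⟩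
        (c₀ * l₁ k + (c₁ * l₂ k + (c₂ * a k + (c₃ * b k + 0#)))) + - p k
          ≡⟨ cong₂ (λ x y → x + - y) (rel k) (p≡0 k) ⟩
        0# + - 0#
          ≡⟨ trans (+-identityˡ _) -0#≈0# ⟩
        0#  ∎
        where open ≡-Reasoning
      trivial : ∀ i → c i ≢ 0# → ⊥
      trivial zero                   cᵢ≢0 = cᵢ≢0 (proj₁ c₀,c₁≡0)
      trivial (suc zero)             cᵢ≢0 = cᵢ≢0 (proj₂ c₀,c₁≡0)
      trivial (suc (suc zero))       cᵢ≢0 = cᵢ≢0 (proj₁ c₂,c₃≡0)
      trivial (suc (suc (suc zero))) cᵢ≢0 = cᵢ≢0 (proj₂ c₂,c₃≡0)

module IncidenceGraph {q₀ : ℕ} (K : FiniteField q₀) (F : FiniteField (q₀ ^ 2))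
  (L : PG2.LineRep K) (P : PG2.Vec K 3) (L-isLine : PG2.IsLine K L) (P∈L : PG2.OnLine K P L)
  (φ : El F → PG2.Vec K 3) (φ-bijection : PG2.IsPointBijection K L φ)
  (ψ : El F → PG2.LineRep K) (ψ-bijection : PG2.IsLineBijection K P ψ) where

  private
    module 𝕂 = FieldProperties K
    module 𝔽 = FieldProperties F
  open PG2 K using (LineRep; OnLine)
  open ProjectivePlane K
  open Construction K F using (ν; InX''; HasSize; Is32Set)

  Flag : El F → El F → Set
  Flag x y = OnLine (φ x) (ψ y)

  φ-nonzero : ∀ x → 𝕂.NonZeroV (φ x)
  φ-nonzero x = proj₁ (proj₁ φ-bijection x)

  φ∉L : ∀ x → ¬ OnLine (φ x) L
  φ∉L x = proj₂ (proj₁ φ-bijection x)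

  φ-injective : ∀ {x x′} → φ x 𝕂.∼ φ x′ → x ≡ x′
  φ-injective = proj₁ (proj₂ φ-bijection) _ _

  ψ-isLine : ∀ y → PG2.IsLine K (ψ y)
  ψ-isLine y = proj₁ (proj₁ ψ-bijection y)

  P∉ψ : ∀ y → ¬ OnLine P (ψ y)
  P∉ψ y = proj₂ (proj₁ ψ-bijection y)

  noQuadrangle : Incidence.NoQuadrangle Flag
  noQuadrangle {x} {x′} x≢x′ x∈y x′∈y x∈y′ x′∈y′ = proj₁ (proj₂ ψ-bijection) _ _
    (two-points-same-line (𝕂.nonzero-≁⇒LinIndep2 (φ-nonzero x) (φ-nonzero x′) (x≢x′ ∘ φ-injective))
       x∈y x′∈y x∈y′ x′∈y′)

  OnL? : ∀ v → Dec (OnLine v L)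
  OnL? v = 𝕂.InSpan2? v (proj₁ L) (proj₂ L)

  -- φ⁻¹ takes the junk value 0# outside the points off L.
  φ⁻¹ : 𝕂.Vec 3 → El F
  φ⁻¹ v with 𝕂.NonZeroV? v | OnL? v
  ... | yes v≢0 | no v∉L = proj₁ (proj₂ (proj₂ φ-bijection) v v≢0 v∉L)
  ... | _       | _      = 𝔽.0#

  φ∘φ⁻¹ : ∀ {v} → 𝕂.NonZeroV v → ¬ OnLine v L → v 𝕂.∼ φ (φ⁻¹ v)
  φ∘φ⁻¹ {v} v≢0 v∉L with 𝕂.NonZeroV? v | OnL? v
  ... | yes v≢0′ | no v∉L′ = proj₂ (proj₂ (proj₂ φ-bijection) v v≢0′ v∉L′)
  ... | no v≡0   | _       = ⊥-elim (v≡0 v≢0)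
  ... | yes _    | yes v∈L = ⊥-elim (v∉L v∈L)

  module _ (y : El F) where
    private
      a = proj₁ (ψ y)
      b = proj₂ (ψ y)

    affinePoints : List (𝕂.Vec 3)
    affinePoints = filter (¬? ∘ OnL?) (𝕂.linePoints a b)

    -- ψ y meets L (lines-meet), and only once, since otherwise it would be L ∋ P.
    length-affinePoints : length affinePoints ≡ q₀
    length-affinePoints = ℕP.suc-injective (trans
      (length-filter-reject-unique OnL? meets-at-most-once meets)
      (𝕂.length-linePoints a b))
      where
      meets-at-most-once : AllPairs (λ v w → OnLine v L → ¬ OnLine w L) (𝕂.linePoints a b)
      meets-at-most-once = AllPairs-with
        (λ (v≢0 , v∈ψ) (w≢0 , w∈ψ) v≁w v∈L w∈L →
           P∉ψ y (common-points-⊆ (𝕂.nonzero-≁⇒LinIndep2 v≢0 w≢0 v≁w) v∈L w∈L v∈ψ w∈ψ P∈L))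
        (All.zip (𝕂.linePoints-nonzero (ψ-isLine y) , 𝕂.linePoints-onLine a b))
        (𝕂.linePoints-distinct (ψ-isLine y))
      meets : Any (λ v → OnLine v L) (𝕂.linePoints a b)
      meets = let p , p≢0 , p∈L , p∈ψ = lines-meet L-isLine (ψ-isLine y)
              in  Any.map (λ p∼v → 𝕂.InSpan2-resp-∼ (𝕂.∼-sym p∼v) p∈L) (𝕂.linePoints-complete p≢0 p∈ψ)

    affinePoints-good : All (λ v → (𝕂.NonZeroV v × ¬ OnLine v L) × OnLine v (ψ y)) affinePoints
    affinePoints-good = All.zip
      ( All.zip (AllP.filter⁺ (¬? ∘ OnL?) (𝕂.linePoints-nonzero (ψ-isLine y)) , AllP.all-filter (¬? ∘ OnL?) _)
      , AllP.filter⁺ (¬? ∘ OnL?) (𝕂.linePoints-onLine a b))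

    pointsOn : List (El F)
    pointsOn = map φ⁻¹ affinePoints

    length-pointsOn : length pointsOn ≡ q₀
    length-pointsOn = trans (ListP.length-map φ⁻¹ affinePoints) length-affinePoints

    pointsOn-flags : All (λ x → Flag x y) pointsOn
    pointsOn-flags = AllP.map⁺ (All.map
      (λ ((v≢0 , v∉L) , v∈ψ) → 𝕂.InSpan2-resp-∼ (𝕂.∼-sym (φ∘φ⁻¹ v≢0 v∉L)) v∈ψ) affinePoints-good)

    pointsOn-unique : Unique pointsOn
    pointsOn-unique = AllPairsP.map⁺ (AllPairs-with
      (λ ((v≢0 , v∉L) , _) ((w≢0 , w∉L) , _) v≁w φ⁻¹v≡φ⁻¹w →
         v≁w (𝕂.∼-trans (φ∘φ⁻¹ v≢0 v∉L) (subst (λ x → φ x 𝕂.∼ _) (sym φ⁻¹v≡φ⁻¹w) (𝕂.∼-sym (φ∘φ⁻¹ w≢0 w∉L)))))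
      affinePoints-good
      (AllPairsP.filter⁺ (¬? ∘ OnL?) (𝕂.linePoints-distinct (ψ-isLine y))))

    pointsOn-complete : ∀ {x} → Flag x y → x ∈ pointsOn
    pointsOn-complete {x} x∈y with find (𝕂.linePoints-complete (φ-nonzero x) x∈y)
    ... | v , v∈line , φx∼v = subst (_∈ pointsOn) (sym x≡φ⁻¹v) (MemP.∈-map⁺ φ⁻¹ v∈affine)
      where
      v∉L : ¬ OnLine v L
      v∉L v∈L = φ∉L x (𝕂.InSpan2-resp-∼ φx∼v v∈L)
      v∈affine : v ∈ affinePoints
      v∈affine = MemP.∈-filter⁺ (¬? ∘ OnL?) v∈line v∉L
      x≡φ⁻¹v : x ≡ φ⁻¹ v
      x≡φ⁻¹v = φ-injective (𝕂.∼-trans φx∼v (φ∘φ⁻¹ (All.lookup (𝕂.linePoints-nonzero (ψ-isLine y)) v∈line) v∉L))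

  flags : List (El F × El F)
  flags = concatMap (λ y → map (_, y) (pointsOn y)) 𝔽.elements

  length-flags : length flags ≡ q₀ ^ 3
  length-flags = begin
    length flags               ≡⟨ length-concatMap _ (λ y → trans (ListP.length-map (_, y) (pointsOn y)) (length-pointsOn y)) 𝔽.elements ⟩
    length 𝔽.elements ℕ.* q₀  ≡⟨ cong (ℕ._* q₀) 𝔽.length-elements ⟩
    q₀ ^ 2 ℕ.* q₀              ≡⟨ ℕP.*-comm (q₀ ^ 2) q₀ ⟩
    q₀ ^ 3                     ∎
    where open ≡-Reasoning

  flags-flags : All (λ (x , y) → Flag x y) flags
  flags-flags = AllP.concat⁺ (AllP.map⁺ (All.universal (λ y → AllP.map⁺ (pointsOn-flags y)) 𝔽.elements))

  flags-unique : Unique flags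
  flags-unique = UniqueP.concat⁺
    (AllP.map⁺ (All.universal (λ y → UniqueP.map⁺ (cong proj₁) (pointsOn-unique y)) 𝔽.elements))
    (AllPairsP.map⁺ (AllPairs.map disjoint 𝔽.elements-unique))
    where
    disjoint : ∀ {y y′} → y ≢ y′ → Disjoint (map (_, y) (pointsOn y)) (map (_, y′) (pointsOn y′))
    disjoint y≢y′ (u∈ , u∈′) with MemP.∈-map⁻ _ u∈ | MemP.∈-map⁻ _ u∈′
    ... | _ , _ , refl | _ , _ , u≡ = y≢y′ (cong proj₂ u≡)

  flags-complete : ∀ {x y} → Flag x y → (x , y) ∈ flags
  flags-complete {x} {y} x∈y =
    MemP.∈-concat⁺′ (MemP.∈-map⁺ (_, y) (pointsOn-complete y x∈y)) (MemP.∈-map⁺ _ (𝔽.∈-elements y))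

  ν-injective : ∀ {x y x′ y′} → ν x y 𝔽.∼ ν x′ y′ → (x , y) ≡ (x′ , y′)
  ν-injective {x} {y} {x′} {y′} (c , _ , ν≡cν′) = cong₂ _,_
    (trans (ν≡cν′ (suc zero)) (trans (cong (𝔽._* x′) c≡1) (𝔽.*-identityˡ x′)))
    (trans (ν≡cν′ (suc (suc (suc (suc zero))))) (trans (cong (𝔽._* y′) c≡1) (𝔽.*-identityˡ y′)))
    where
    c≡1 : c ≡ 𝔽.1#
    c≡1 = sym (trans (ν≡cν′ zero) (𝔽.*-identityʳ c))

  hasSize : HasSize (InX'' φ ψ) (q₀ ^ 3)
  hasSize = map (λ (x , y) → ν x y) flags
          , trans (ListP.length-map _ flags) length-flags
          , AllP.map⁺ (All.map (λ {(x , y)} x∈y → x , y , x∈y , 𝔽.∼-refl (ν x y)) flags-flags)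
          , AllPairsP.map⁺ (AllPairs.map (λ ≢ ∼ → ≢ (ν-injective ∼)) flags-unique)
          , λ { v (x , y , x∈y , v∼ν) → AnyP.map⁺ (Any.map (λ { refl → v∼ν }) (flags-complete x∈y)) }

  no-four-in-plane : ∀ {a b c} (V : Fin 4 → 𝔽.Vec 7) → (∀ i → InX'' φ ψ (V i)) →
    (∀ {i j} → i ≢ j → ¬ V i 𝔽.∼ V j) → (∀ i → 𝔽.InSpan3 (V i) a b c) → ⊥
  no-four-in-plane {a} {b} {c} V V∈X″ distinct V∈⟨abc⟩ = from-relation
    (𝔽.combinations-LinDep (ℕ.s≤s (ℕ.s≤s (ℕ.s≤s (ℕ.s≤s ℕ.z≤n)))) (triple a b c) (λ i → ν (X i) (Y i))
       (λ i → 𝔽.Combination-resp-∼ {B = triple a b c} (𝔽.∼-sym (V∼ν i)) (𝔽.InSpan3⇒Combination (V∈⟨abc⟩ i))))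
    where
    X Y : Fin 4 → El F
    X i = proj₁ (V∈X″ i)
    Y i = proj₁ (proj₂ (V∈X″ i))
    flag : ∀ i → Flag (X i) (Y i)
    flag i = proj₁ (proj₂ (proj₂ (V∈X″ i)))
    V∼ν : ∀ i → V i 𝔽.∼ ν (X i) (Y i)
    V∼ν i = proj₂ (proj₂ (proj₂ (V∈X″ i)))

    distinct-flags : ∀ {i j} → i ≢ j → X i ≡ X j → Y i ≢ Y j
    distinct-flags {i} {j} i≢j Xᵢ≡Xⱼ Yᵢ≡Yⱼ = distinct i≢j
      (𝔽.∼-trans (V∼ν i) (subst₂ (λ x y → ν x y 𝔽.∼ V j) (sym Xᵢ≡Xⱼ) (sym Yᵢ≡Yⱼ) (𝔽.∼-sym (V∼ν j))))

    from-relation : 𝔽.LinDep (λ i → ν (X i) (Y i)) → ⊥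
    from-relation (C , (i , Cᵢ≢0) , rel) = Incidence.paired-flags-empty Flag noQuadrangle
      (λ i → C i ≢ 𝔽.0#) X Y flag distinct-flags
      (𝔽.moments-relation-paired C X relX) (𝔽.moments-relation-paired C Y relY) i Cᵢ≢0
      where
      relX : 𝔽.LinRelation (𝔽.moments ∘ X) C
      relX zero                   = rel zero
      relX (suc zero)             = rel (suc zero)
      relX (suc (suc zero))       = rel (suc (suc zero))
      relX (suc (suc (suc zero))) = rel (suc (suc (suc zero)))
      relY : 𝔽.LinRelation (𝔽.moments ∘ Y) C
      relY zero                   = rel zero
      relY (suc zero)             = rel (suc (suc (suc (suc zero))))
      relY (suc (suc zero))       = rel (suc (suc (suc (suc (suc zero)))))
      relY (suc (suc (suc zero))) = rel (suc (suc (suc (suc (suc (suc zero))))))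

  is32 : Is32Set (InX'' φ ψ)
  is32 a b c _ []                        _ _ _ = ℕ.z≤n
  is32 a b c _ (_ ∷ [])                  _ _ _ = ℕ.s≤s ℕ.z≤n
  is32 a b c _ (_ ∷ _ ∷ [])              _ _ _ = ℕ.s≤s (ℕ.s≤s ℕ.z≤n)
  is32 a b c _ (_ ∷ _ ∷ _ ∷ [])          _ _ _ = ℕ.s≤s (ℕ.s≤s (ℕ.s≤s ℕ.z≤n))
  is32 a b c _ vs@(_ ∷ _ ∷ _ ∷ _ ∷ _) vs∈X″ distinct vs∈⟨abc⟩ = ⊥-elim (no-four-in-plane
    (List.lookup (List.take 4 vs))
    (AllP.tabulate⁻ (AllP.take⁺ 4 vs∈X″))
    (AllPairs-tabulate⁻ (λ v≁w w∼v → v≁w (𝔽.∼-sym w∼v)) (AllPairsP.take⁺ 4 distinct))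
    (AllP.tabulate⁻ (AllP.take⁺ 4 vs∈⟨abc⟩)))

corollary10 : (q0 : ℕ) (K : FiniteField q0) (F : FiniteField (q0 ^ 2))
    (L : PG2.LineRep K) (P : PG2.Vec K 3) →
    PG2.IsLine K L → PG2.NonZeroV K P → PG2.OnLine K P L →
    (φ : El F → PG2.Vec K 3) → PG2.IsPointBijection K L φ →
    (ψ : El F → PG2.LineRep K) → PG2.IsLineBijection K P ψ →
    Construction.HasSize K F (Construction.InX'' K F φ ψ) (q0 ^ 3)
      × Construction.Is32Set K F (Construction.InX'' K F φ ψ)
corollary10 q0 K F L P L-isLine _ P∈L φ φ-bijection ψ ψ-bijection = G′.hasSize , G′.is32
  where module G′ = IncidenceGraph K F L P L-isLine P∈L φ φ-bijection ψ ψ-bijection
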